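{- Let $f\colon S_n\to\mathbb{R}$ and let \[a_{ij}=\frac{n-1}{n}\big(\mathbb{E}[f_{i\to j}]-\mathbb{E}[f]\big).\] Then $\sum_{i,j}a_{ij}x_{i\to j}$ is in normalized form and equals $f^{=1}$.
   Context: $x_{i\to j}(\pi)=1_{\pi(i)=j}$ on $S_n$. A combination $\sum a_{ij}x_{i\to j}$ is in normalized form if all row sums $\sum_j a_{ij}$ and column sums $\sum_i a_{ij}$ vanish. $\mathbb{E}[f]=\mathbb{E}_{\sigma\sim S_n}f(\sigma)$ and $\mathbb{E}[f_{i\to j}]=\mathbb{E}_{\sigma\sim S_n}[f(\sigma)\mid\sigma(i)=j]$. With the inner product $\langle u,v\rangle=\mathbb{E}[uv]$, $W_1$ is the span of the $x_{i\to j}$, $W_0$ the constants, $V_{=1}=W_1\cap W_0^\perp$, and $f^{=1}$ is the orthogonal projection of $f$ onto $V_{=1}$.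
   Formalization: The function f takes values in ℚ rather than ℝ, and the spaces $W_1$, $W_0$ and $V_{=1}$ used to define $f^{=1}$ are taken over ℚ. -}

module Defs where

open import Data.Nat using (ℕ; zero; suc)
import Data.Nat as ℕ
open import Data.Integer using (+_)
open import Data.Fin using (Fin; _≟_)
open import Data.Fin.Properties using (all?)
open import Data.List using (List; []; _∷_; map; concatMap; filter; length; foldr; allFin)
open import Data.Vec.Functional using () renaming (_∷_ to _∷ᶠ_)
open import Data.Product using (Σ; _×_)
open import Data.Bool using (if_then_else_)
open import Relation.Nullary.Decidable using (Dec; _→-dec_; does)
open import Relation.Binary.PropositionalEquality using (_≡_)
open import Data.Rational using (ℚ; 0ℚ; 1ℚ; _+_; _*_; _-_; _/_)

-- Maps Fin n → Fin n; the symmetric group S_n is the set of those that are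
-- injective (equivalently bijective, since Fin n is finite).
Map : ℕ → Set
Map n = Fin n → Fin n

allMaps : (m n : ℕ) → List (Fin m → Fin n)
allMaps zero    n = (λ ()) ∷ []
allMaps (suc m) n = concatMap (λ k → map (λ g → k ∷ᶠ g) (allMaps m n)) (allFin n)

IsPerm : ∀ {n} → Map n → Set
IsPerm {n} σ = ∀ i j → σ i ≡ σ j → i ≡ j

isPerm? : ∀ {n} (σ : Map n) → Dec (IsPerm σ)
isPerm? σ = all? (λ i → all? (λ j → (σ i ≟ σ j) →-dec (i ≟ j)))

Sn : (n : ℕ) → List (Map n)
Sn n = filter isPerm? (allMaps n n)

sumℚ : List ℚ → ℚ
sumℚ = foldr _+_ 0ℚ

Σᶠ : ∀ {n} → (Fin n → ℚ) → ℚ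
Σᶠ {n} g = sumℚ (map g (allFin n))

ℕ→ℚ : ℕ → ℚ
ℕ→ℚ k = + k / 1

-- 1/k for k > 0 (only ever applied to positive k below; inv 0 = 0 is a dummy)
inv : ℕ → ℚ
inv zero    = 0ℚ
inv (suc k) = + 1 / suc k

-- functions on S_n (values off S_n are irrelevant: every notion below only
-- looks at values on permutations)
Fun : ℕ → Set
Fun n = Map n → ℚ

𝔼 : ∀ {n} → Fun n → ℚ
𝔼 {n} f = sumℚ (map f (Sn n)) * inv (length (Sn n))

-- 𝔼[f_{i→j}] = 𝔼_{σ ∼ S_n}[f(σ) | σ(i) = j]
𝔼→ : ∀ {n} → Fun n → Fin n → Fin n → ℚ
𝔼→ {n} f i j = sumℚ (map f S) * inv (length S)
  where S = filter (λ σ → σ i ≟ j) (Sn n)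

x→ : ∀ {n} → Fin n → Fin n → Fun n
x→ i j π = if does (π i ≟ j) then 1ℚ else 0ℚ

lin : ∀ {n} → (Fin n → Fin n → ℚ) → Fun n
lin a π = Σᶠ (λ i → Σᶠ (λ j → a i j * x→ i j π))

Normalized : ∀ {n} → (Fin n → Fin n → ℚ) → Set
Normalized a = (∀ i → Σᶠ (λ j → a i j) ≡ 0ℚ) × (∀ j → Σᶠ (λ i → a i j) ≡ 0ℚ)

⟨_,_⟩ : ∀ {n} → Fun n → Fun n → ℚ
⟨ u , v ⟩ = 𝔼 (λ σ → u σ * v σ)

_≐_ : ∀ {n} → Fun n → Fun n → Set
_≐_ {n} u v = ∀ σ → IsPerm σ → u σ ≡ v σ

InW1 : ∀ {n} → Fun n → Set
InW1 {n} v = Σ (Fin n → Fin n → ℚ) (λ b → v ≐ lin b)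

InV1 : ∀ {n} → Fun n → Set
InV1 v = InW1 v × (∀ c → ⟨ v , (λ _ → c) ⟩ ≡ 0ℚ)

IsProjV1 : ∀ {n} → Fun n → Fun n → Set
IsProjV1 f g = InV1 g × (∀ v → InV1 v → ⟨ (λ σ → f σ - g σ) , v ⟩ ≡ 0ℚ)

coeff : ∀ {n} → Fun n → Fin n → Fin n → ℚ
coeff {n} f i j = (ℕ→ℚ (n ℕ.∸ 1) * inv n) * (𝔼→ f i j - 𝔼 f)

{-# OPTIONS --safe #-}
module Submission where

-- Let c = #{σ : σ(i) = j}, which does not depend on (i, j) and satisfies n·c = n!, let
-- F = Σ_σ f(σ) and F_ij = Σ_{σ(i)=j} f(σ), so that a_ij = (n-1)/n · (F_ij/c − F/n!).
-- Every row and every column of (F_ij) sums to F, hence a is normalized.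
-- For g = Σ a_ij x_{i→j} one has Σ_{σ(k)=l} g(σ) = Σ_ij a_ij P_ijkl with the pair counts
-- P_ijkl = #{σ : σ(i) = j, σ(k) = l}. Relabelling positions and values shows that P_ijkl is c
-- on the diagonal, 0 when exactly one of i = k, j = l holds, and d = c/(n-1) otherwise; as a is
-- normalized the sum collapses to a_kl (c + d) = F_kl − F/n. So Σ_{σ(k)=l} (f − g)(σ) = F/n does
-- not depend on (k, l), which makes f − g orthogonal to every Σ b_kl x_{k→l} with Σ b_kl = 0,
-- that is to V_{=1}; and g ∈ V_{=1} because Σ_σ g(σ) = c Σ a_ij = 0.

open import Defs
open import Data.Bool using (true; false; if_then_else_)
open import Data.Empty using (⊥-elim)
open import Data.Fin using (Fin; zero; suc; _≟_; _<_; punchOut)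
open import Data.Fin.Permutation using (Permutation; _⟨$⟩ʳ_; _⟨$⟩ˡ_; inverseˡ; inverseʳ; flip; transpose)
open import Data.Fin.Properties using (all?; any?; pigeonhole; punchOut-injective; <⇒≢; suc-injective)
import Data.Integer as ℤ
import Data.Integer.Properties as ℤ
open import Data.List using (List; []; _∷_; map; concatMap; filter; length; allFin; _++_)
open import Data.List.Properties using (length-tabulate; map-tabulate)
open import Data.Nat using (ℕ; zero; suc; 2+)
open import Data.Nat.Coprimality using (1-coprimeTo; sym)
open import Data.Nat.Properties using (n<1+n)
open import Data.Product using (∃; ∃₂; _×_; _,_)
open import Data.Rational using (ℚ; 0ℚ; 1ℚ; _+_; _*_; _-_; -_; 1/_; mkℚ; toℚᵘ)
open import Data.Rational.Properties
  using ( 1≢0; normalize-coprime; toℚᵘ-injective; toℚᵘ-fromℚᵘ; toℚᵘ-homo-+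
        ; +-identityˡ; +-identityʳ; +-assoc; *-identityˡ; *-identityʳ; *-zeroˡ; *-zeroʳ
        ; *-assoc; *-comm; *-distribˡ-+; *-inverseʳ )
open import Data.Rational.Solver using (module +-*-Solver)
import Data.Rational.Unnormalised as ℚᵘ
import Data.Rational.Unnormalised.Properties as ℚᵘ
open import Data.Vec.Functional using () renaming (_∷_ to _∷ᶠ_)
open import Function using (_∘_; id)
open import Function.Bundles using (Injection; mk⇔)
open import Function.Definitions using (Congruent)
open import Function.Properties.Inverse using (↔⇒↣)
open import Relation.Binary.PropositionalEquality as ≡
  using (_≡_; _≢_; _≗_; refl; cong; cong₂; trans)
open import Relation.Nullary using (Dec; yes; no; does; ¬_)
open import Relation.Nullary.Decidable using (_×-dec_; dec-true; dec-false; does-⇔)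

open +-*-Solver

-- ℕ→ℚ k = + k / 1 is definitionally fromℚᵘ (mkℚᵘ (+ k) 0), which is what the first step uses.
ℕ→ℚ-suc : ∀ k → ℕ→ℚ (suc k) ≡ 1ℚ + ℕ→ℚ k
ℕ→ℚ-suc k = toℚᵘ-injective (begin-equality
  toℚᵘ (ℕ→ℚ (suc k))             ≃⟨ toℚᵘ-fromℚᵘ (ℚᵘ.mkℚᵘ (ℤ.+ suc k) 0) ⟩
  ℚᵘ.mkℚᵘ (ℤ.+ suc k) 0          ≃⟨ ℚᵘ.*≡* numerators ⟩
  ℚᵘ.1ℚᵘ ℚᵘ.+ ℚᵘ.mkℚᵘ (ℤ.+ k) 0  ≃⟨ ℚᵘ.≃-sym (ℚᵘ.+-cong (toℚᵘ-fromℚᵘ ℚᵘ.1ℚᵘ)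
                                                        (toℚᵘ-fromℚᵘ (ℚᵘ.mkℚᵘ (ℤ.+ k) 0))) ⟩
  toℚᵘ 1ℚ ℚᵘ.+ toℚᵘ (ℕ→ℚ k)      ≃⟨ ℚᵘ.≃-sym (toℚᵘ-homo-+ 1ℚ (ℕ→ℚ k)) ⟩
  toℚᵘ (1ℚ + ℕ→ℚ k)              ∎)
  where
  open ℚᵘ.≤-Reasoning
  numerators : ℤ.+ suc k ℤ.* ℤ.+ 1 ≡ (ℤ.+ 1 ℤ.* ℤ.+ 1 ℤ.+ ℤ.+ k ℤ.* ℤ.+ 1) ℤ.* ℤ.+ 1
  numerators = trans (ℤ.*-identityʳ (ℤ.+ suc k))
    (≡.sym (trans (ℤ.*-identityʳ _) (cong (ℤ._+_ (ℤ.+ 1)) (ℤ.*-identityʳ (ℤ.+ k)))))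

ℕ→ℚ-*-inv : ∀ {k} → k ≢ 0 → ℕ→ℚ k * inv k ≡ 1ℚ
ℕ→ℚ-*-inv {zero}  k≢0 = ⊥-elim (k≢0 refl)
ℕ→ℚ-*-inv {suc k} _   = begin
  ℕ→ℚ (suc k) * inv (suc k)  ≡⟨ cong₂ _*_ (normalize-coprime (sym (1-coprimeTo (suc k))))
                                           (normalize-coprime (1-coprimeTo (suc k))) ⟩
  p * 1/ p                   ≡⟨ *-inverseʳ p ⟩
  1ℚ                         ∎
  where
  open ≡.≡-Reasoning
  p = mkℚ (ℤ.+ suc k) 0 (sym (1-coprimeTo (suc k)))

*-inverse-unique : ∀ {x y z} → x * y ≡ 1ℚ → x * z ≡ 1ℚ → y ≡ z
*-inverse-unique {x} {y} {z} xy≡1 xz≡1 = begin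
  y            ≡⟨ ≡.sym (*-identityʳ y) ⟩
  y * 1ℚ       ≡⟨ cong (y *_) (≡.sym xz≡1) ⟩
  y * (x * z)  ≡⟨ solve 3 (λ x y z → y :* (x :* z) := (x :* y) :* z) refl x y z ⟩
  (x * y) * z  ≡⟨ cong (_* z) xy≡1 ⟩
  1ℚ * z       ≡⟨ *-identityˡ z ⟩
  z            ∎
  where open ≡.≡-Reasoning

x*y≡0⇒x≡0 : ∀ {x y z} → y * z ≡ 1ℚ → x * y ≡ 0ℚ → x ≡ 0ℚ
x*y≡0⇒x≡0 {x} {y} {z} yz≡1 xy≡0 = begin
  x            ≡⟨ ≡.sym (*-identityʳ x) ⟩
  x * 1ℚ       ≡⟨ cong (x *_) (≡.sym yz≡1) ⟩
  x * (y * z)  ≡⟨ ≡.sym (*-assoc x y z) ⟩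
  (x * y) * z  ≡⟨ cong (_* z) xy≡0 ⟩
  0ℚ * z       ≡⟨ *-zeroˡ z ⟩
  0ℚ           ∎
  where open ≡.≡-Reasoning

𝟙 : {P : Set} → Dec P → ℚ
𝟙 P? = if does P? then 1ℚ else 0ℚ

module _ {P : Set} where

  𝟙-yes : (P? : Dec P) → P → 𝟙 P? ≡ 1ℚ
  𝟙-yes P? p = cong (if_then 1ℚ else 0ℚ) (dec-true P? p)

  𝟙-no : (P? : Dec P) → ¬ P → 𝟙 P? ≡ 0ℚ
  𝟙-no P? ¬p = cong (if_then 1ℚ else 0ℚ) (dec-false P? ¬p)

  𝟙-⇔ : {Q : Set} (P? : Dec P) (Q? : Dec Q) → (P → Q) → (Q → P) → 𝟙 P? ≡ 𝟙 Q?
  𝟙-⇔ P? Q? to from = cong (if_then 1ℚ else 0ℚ) (does-⇔ (mk⇔ to from) P? Q?)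

  𝟙-idem : (P? : Dec P) → 𝟙 P? * 𝟙 P? ≡ 𝟙 P?
  𝟙-idem P? with does P?
  ... | true  = *-identityˡ 1ℚ
  ... | false = *-zeroˡ 0ℚ

  𝟙-× : {Q : Set} (P? : Dec P) (Q? : Dec Q) → 𝟙 (P? ×-dec Q?) ≡ 𝟙 P? * 𝟙 Q?
  𝟙-× P? Q? with does P?
  ... | true  = ≡.sym (*-identityˡ (𝟙 Q?))
  ... | false = ≡.sym (*-zeroˡ (𝟙 Q?))

  𝟙-*-cong : (P? : Dec P) {x y : ℚ} → (P → x ≡ y) → 𝟙 P? * x ≡ 𝟙 P? * y
  𝟙-*-cong (yes p) x≡y = cong (1ℚ *_) (x≡y p)
  𝟙-*-cong (no _) {x} {y} _ = trans (*-zeroˡ x) (≡.sym (*-zeroˡ y))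

∑ : {A : Set} → List A → (A → ℚ) → ℚ
∑ xs h = sumℚ (map h xs)

syntax ∑ xs (λ x → h) = ∑[ x ← xs ] h

module _ {A : Set} where

  ∑-cong : ∀ (xs : List A) {g h : A → ℚ} → (∀ x → g x ≡ h x) → ∑ xs g ≡ ∑ xs h
  ∑-cong []       _   = refl
  ∑-cong (x ∷ xs) g≗h = cong₂ _+_ (g≗h x) (∑-cong xs g≗h)

  ∑-≡0 : ∀ (xs : List A) {h : A → ℚ} → (∀ x → h x ≡ 0ℚ) → ∑ xs h ≡ 0ℚ
  ∑-≡0 []       _   = refl
  ∑-≡0 (x ∷ xs) h≗0 = trans (cong₂ _+_ (h≗0 x) (∑-≡0 xs h≗0)) (+-identityˡ 0ℚ)

  ∑-+ : ∀ (xs : List A) (g h : A → ℚ) → ∑[ x ← xs ] (g x + h x) ≡ ∑ xs g + ∑ xs h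
  ∑-+ []       g h = refl
  ∑-+ (x ∷ xs) g h = trans (cong (g x + h x +_) (∑-+ xs g h))
    (solve 4 (λ a b c d → (a :+ b) :+ (c :+ d) := (a :+ c) :+ (b :+ d)) refl (g x) (h x) (∑ xs g) (∑ xs h))

  ∑-- : ∀ (xs : List A) (g h : A → ℚ) → ∑[ x ← xs ] (g x - h x) ≡ ∑ xs g - ∑ xs h
  ∑-- []       g h = refl
  ∑-- (x ∷ xs) g h = trans (cong (g x - h x +_) (∑-- xs g h))
    (solve 4 (λ a b c d → (a :- b) :+ (c :- d) := (a :+ c) :- (b :+ d)) refl (g x) (h x) (∑ xs g) (∑ xs h))

  ∑-*ˡ : ∀ (xs : List A) (c : ℚ) (h : A → ℚ) → ∑[ x ← xs ] (c * h x) ≡ c * ∑ xs h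
  ∑-*ˡ []       c h = ≡.sym (*-zeroʳ c)
  ∑-*ˡ (x ∷ xs) c h = trans (cong (c * h x +_) (∑-*ˡ xs c h)) (≡.sym (*-distribˡ-+ c (h x) (∑ xs h)))

  ∑-*ʳ : ∀ (xs : List A) (c : ℚ) (h : A → ℚ) → ∑[ x ← xs ] (h x * c) ≡ ∑ xs h * c
  ∑-*ʳ xs c h = trans (∑-cong xs (λ x → *-comm (h x) c)) (trans (∑-*ˡ xs c h) (*-comm c (∑ xs h)))

  ∑-++ : ∀ (xs ys : List A) (h : A → ℚ) → ∑ (xs ++ ys) h ≡ ∑ xs h + ∑ ys h
  ∑-++ []       ys h = ≡.sym (+-identityˡ (∑ ys h))
  ∑-++ (x ∷ xs) ys h = trans (cong (h x +_) (∑-++ xs ys h)) (≡.sym (+-assoc (h x) (∑ xs h) (∑ ys h)))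

  ∑-1 : ∀ (xs : List A) → ℕ→ℚ (length xs) ≡ ∑[ _ ← xs ] 1ℚ
  ∑-1 []       = refl
  ∑-1 (x ∷ xs) = trans (ℕ→ℚ-suc (length xs)) (cong (1ℚ +_) (∑-1 xs))

  ∑-filter : ∀ {P : A → Set} (P? : ∀ x → Dec (P x)) (xs : List A) (h : A → ℚ) →
             ∑ (filter P? xs) h ≡ ∑[ x ← xs ] (𝟙 (P? x) * h x)
  ∑-filter P? []       h = refl
  ∑-filter P? (x ∷ xs) h with does (P? x)
  ... | true  = cong₂ _+_ (≡.sym (*-identityˡ (h x))) (∑-filter P? xs h)
  ... | false = trans (∑-filter P? xs h) (≡.sym (trans (cong (_+ _) (*-zeroˡ (h x))) (+-identityˡ _)))

  ∑-filter-cong : ∀ {P : A → Set} (P? : ∀ x → Dec (P x)) (xs : List A) {g h : A → ℚ} →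
                  (∀ x → P x → g x ≡ h x) → ∑ (filter P? xs) g ≡ ∑ (filter P? xs) h
  ∑-filter-cong P? xs {g} {h} g≗h = begin
    ∑ (filter P? xs) g            ≡⟨ ∑-filter P? xs g ⟩
    ∑[ x ← xs ] (𝟙 (P? x) * g x)  ≡⟨ ∑-cong xs (λ x → 𝟙-*-cong (P? x) (g≗h x)) ⟩
    ∑[ x ← xs ] (𝟙 (P? x) * h x)  ≡⟨ ≡.sym (∑-filter P? xs h) ⟩
    ∑ (filter P? xs) h            ∎
    where open ≡.≡-Reasoning

module _ {A B : Set} where

  ∑-map : ∀ (f : A → B) (xs : List A) (h : B → ℚ) → ∑ (map f xs) h ≡ ∑ xs (h ∘ f)
  ∑-map f []       h = refl
  ∑-map f (x ∷ xs) h = cong (h (f x) +_) (∑-map f xs h)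

  ∑-concatMap : ∀ (f : A → List B) (xs : List A) (h : B → ℚ) →
                ∑ (concatMap f xs) h ≡ ∑[ x ← xs ] ∑ (f x) h
  ∑-concatMap f []       h = refl
  ∑-concatMap f (x ∷ xs) h =
    trans (∑-++ (f x) (concatMap f xs) h) (cong (∑ (f x) h +_) (∑-concatMap f xs h))

  ∑-comm : ∀ (xs : List A) (ys : List B) (h : A → B → ℚ) →
           ∑[ x ← xs ] ∑[ y ← ys ] h x y ≡ ∑[ y ← ys ] ∑[ x ← xs ] h x y
  ∑-comm []       ys h = ≡.sym (∑-≡0 ys (λ _ → refl))
  ∑-comm (x ∷ xs) ys h = trans (cong (∑ ys (h x) +_) (∑-comm xs ys h))
    (≡.sym (∑-+ ys (h x) (λ y → ∑[ x′ ← xs ] h x′ y)))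

Σᶠ-suc : ∀ {n} (g : Fin (suc n) → ℚ) → Σᶠ g ≡ g zero + Σᶠ (g ∘ suc)
Σᶠ-suc {n} g = cong (λ xs → g zero + sumℚ xs)
  (trans (map-tabulate suc g) (≡.sym (map-tabulate id (g ∘ suc))))

Σᶠ-single : ∀ {n} {h : Fin n → ℚ} (l : Fin n) → (∀ j → j ≢ l → h j ≡ 0ℚ) → Σᶠ h ≡ h l
Σᶠ-single {suc n} {h} zero    h≗0 = begin
  Σᶠ h                   ≡⟨ Σᶠ-suc h ⟩
  h zero + Σᶠ (h ∘ suc)  ≡⟨ cong (h zero +_) (∑-≡0 (allFin n) (λ j → h≗0 (suc j) (λ ()))) ⟩
  h zero + 0ℚ            ≡⟨ +-identityʳ (h zero) ⟩
  h zero                 ∎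
  where open ≡.≡-Reasoning
Σᶠ-single {suc n} {h} (suc l) h≗0 = begin
  Σᶠ h                   ≡⟨ Σᶠ-suc h ⟩
  h zero + Σᶠ (h ∘ suc)  ≡⟨ cong₂ _+_ (h≗0 zero (λ ()))
                                      (Σᶠ-single l (λ j j≢l → h≗0 (suc j) (j≢l ∘ suc-injective))) ⟩
  0ℚ + h (suc l)         ≡⟨ +-identityˡ (h (suc l)) ⟩
  h (suc l)              ∎
  where open ≡.≡-Reasoning

Σᶠ-const : ∀ n (x : ℚ) → Σᶠ {n} (λ _ → x) ≡ ℕ→ℚ n * x
Σᶠ-const n x = begin
  Σᶠ {n} (λ _ → x)             ≡⟨ ∑-cong (allFin n) (λ _ → ≡.sym (*-identityˡ x)) ⟩
  ∑[ _ ← allFin n ] (1ℚ * x)   ≡⟨ ∑-*ʳ (allFin n) x (λ _ → 1ℚ) ⟩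
  ∑[ _ ← allFin n ] 1ℚ * x     ≡⟨ cong (_* x) (≡.sym (∑-1 (allFin n))) ⟩
  ℕ→ℚ (length (allFin n)) * x  ≡⟨ cong (λ k → ℕ→ℚ k * x) (length-tabulate {n = n} id) ⟩
  ℕ→ℚ n * x                    ∎
  where open ≡.≡-Reasoning

Σᶠ-*-𝟙 : ∀ {n} (g : Fin n → ℚ) (l : Fin n) → Σᶠ (λ j → g j * 𝟙 (j ≟ l)) ≡ g l
Σᶠ-*-𝟙 g l = trans (Σᶠ-single l (λ j j≢l → trans (cong (g j *_) (𝟙-no (j ≟ l) j≢l)) (*-zeroʳ (g j))))
  (trans (cong (g l *_) (𝟙-yes (l ≟ l) refl)) (*-identityʳ (g l)))

Σᶠ-*-affine-𝟙 : ∀ {n} (A : Fin n → ℚ) → Σᶠ A ≡ 0ℚ →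
                ∀ α β l → Σᶠ (λ j → A j * (α * 𝟙 (j ≟ l) + β)) ≡ A l * α
Σᶠ-*-affine-𝟙 {n} A ΣA≡0 α β l = begin
  Σᶠ (λ j → A j * (α * 𝟙 (j ≟ l) + β))
    ≡⟨ ∑-cong (allFin n) (λ j → solve 4 (λ a α y β → a :* (α :* y :+ β) := α :* (a :* y) :+ β :* a)
                                         refl (A j) α (𝟙 (j ≟ l)) β) ⟩
  Σᶠ (λ j → α * (A j * 𝟙 (j ≟ l)) + β * A j)
    ≡⟨ ∑-+ (allFin n) (λ j → α * (A j * 𝟙 (j ≟ l))) (λ j → β * A j) ⟩
  Σᶠ (λ j → α * (A j * 𝟙 (j ≟ l))) + Σᶠ (λ j → β * A j)
    ≡⟨ cong₂ _+_ (∑-*ˡ (allFin n) α (λ j → A j * 𝟙 (j ≟ l))) (∑-*ˡ (allFin n) β A) ⟩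
  α * Σᶠ (λ j → A j * 𝟙 (j ≟ l)) + β * Σᶠ A
    ≡⟨ cong₂ (λ x y → α * x + β * y) (Σᶠ-*-𝟙 A l) ΣA≡0 ⟩
  α * A l + β * 0ℚ
    ≡⟨ solve 3 (λ α a β → α :* a :+ β :* con 0ℚ := a :* α) refl α (A l) β ⟩
  A l * α ∎
  where open ≡.≡-Reasoning

Σᶠ² : ∀ {n} → (Fin n → Fin n → ℚ) → ℚ
Σᶠ² b = Σᶠ (λ i → Σᶠ (λ j → b i j))

Σᶠ²-*ʳ : ∀ {n} (b : Fin n → Fin n → ℚ) t → Σᶠ² (λ i j → b i j * t) ≡ Σᶠ² b * t
Σᶠ²-*ʳ {n} b t =
  trans (∑-cong (allFin n) (λ i → ∑-*ʳ (allFin n) t (b i))) (∑-*ʳ (allFin n) t (λ i → Σᶠ (b i)))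

Normalized⇒Σᶠ²≡0 : ∀ {n} {a : Fin n → Fin n → ℚ} → Normalized a → Σᶠ² a ≡ 0ℚ
Normalized⇒Σᶠ²≡0 {n} (rows , _) = ∑-≡0 (allFin n) rows

pairPattern : (c d x y : ℚ) → ℚ
pairPattern c d x y = x * y * c + (1ℚ - x) * (1ℚ - y) * d

Normalized⇒Σᶠ²-pairPattern : ∀ {n} {A : Fin n → Fin n → ℚ} → Normalized A → ∀ c d k l →
                             Σᶠ² (λ i j → A i j * pairPattern c d (𝟙 (i ≟ k)) (𝟙 (j ≟ l))) ≡ A k l * (c + d)
Normalized⇒Σᶠ²-pairPattern {n} {A} (rows , columns) c d k l = begin
  Σᶠ (λ i → Σᶠ (λ j → A i j * pairPattern c d (𝟙 (i ≟ k)) (𝟙 (j ≟ l))))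
    ≡⟨ ∑-cong (allFin n) (λ i → trans
         (∑-cong (allFin n) (λ j → cong (A i j *_) (inner-affine (𝟙 (i ≟ k)) (𝟙 (j ≟ l)))))
         (Σᶠ-*-affine-𝟙 (A i) (rows i) _ _ l)) ⟩
  Σᶠ (λ i → A i l * (𝟙 (i ≟ k) * c - (1ℚ - 𝟙 (i ≟ k)) * d))
    ≡⟨ ∑-cong (allFin n) (λ i → cong (A i l *_) (outer-affine (𝟙 (i ≟ k)))) ⟩
  Σᶠ (λ i → A i l * ((c + d) * 𝟙 (i ≟ k) + - d))
    ≡⟨ Σᶠ-*-affine-𝟙 (λ i → A i l) (columns l) (c + d) (- d) k ⟩
  A k l * (c + d) ∎
  where
  open ≡.≡-Reasoning
  inner-affine : ∀ x y → pairPattern c d x y ≡ (x * c - (1ℚ - x) * d) * y + (1ℚ - x) * d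
  inner-affine x y = solve 4 (λ x y c d → x :* y :* c :+ (con 1ℚ :- x) :* (con 1ℚ :- y) :* d
                                       := (x :* c :- (con 1ℚ :- x) :* d) :* y :+ (con 1ℚ :- x) :* d)
                             refl x y c d
  outer-affine : ∀ x → x * c - (1ℚ - x) * d ≡ (c + d) * x + - d
  outer-affine x = solve 3 (λ x c d → x :* c :- (con 1ℚ :- x) :* d := (c :+ d) :* x :+ :- d) refl x c d

_≗?_ : ∀ {m n} (σ τ : Fin m → Fin n) → Dec (σ ≗ τ)
σ ≗? τ = all? (λ i → σ i ≟ τ i)

𝟙-≗-∷ : ∀ {m n} (σ : Fin (suc m) → Fin n) k (τ : Fin m → Fin n) →
        𝟙 (σ ≗? (k ∷ᶠ τ)) ≡ 𝟙 (σ zero ≟ k) * 𝟙 ((σ ∘ suc) ≗? τ)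
𝟙-≗-∷ σ k τ = trans (𝟙-⇔ (σ ≗? (k ∷ᶠ τ)) ((σ zero ≟ k) ×-dec ((σ ∘ suc) ≗? τ)) split join)
                    (𝟙-× (σ zero ≟ k) ((σ ∘ suc) ≗? τ))
  where
  split : σ ≗ (k ∷ᶠ τ) → σ zero ≡ k × (σ ∘ suc) ≗ τ
  split σ≗ = σ≗ zero , σ≗ ∘ suc
  join : σ zero ≡ k × (σ ∘ suc) ≗ τ → σ ≗ (k ∷ᶠ τ)
  join (σ0≡k , _) zero    = σ0≡k
  join (_ , σs≗τ) (suc i) = σs≗τ i

∑-allMaps-𝟙≗ : ∀ {m n} (σ : Fin m → Fin n) → ∑[ τ ← allMaps m n ] 𝟙 (σ ≗? τ) ≡ 1ℚ
∑-allMaps-𝟙≗ {zero}      σ = trans (cong (_+ 0ℚ) (𝟙-yes (σ ≗? λ ()) (λ ()))) (+-identityʳ 1ℚ)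
∑-allMaps-𝟙≗ {suc m} {n} σ = begin
  ∑[ τ ← allMaps (suc m) n ] 𝟙 (σ ≗? τ)
    ≡⟨ ∑-concatMap (λ k → map (k ∷ᶠ_) (allMaps m n)) (allFin n) (λ τ → 𝟙 (σ ≗? τ)) ⟩
  Σᶠ (λ k → ∑[ τ ← map (k ∷ᶠ_) (allMaps m n) ] 𝟙 (σ ≗? τ))
    ≡⟨ ∑-cong (allFin n) (λ k → ∑-map (k ∷ᶠ_) (allMaps m n) (λ τ → 𝟙 (σ ≗? τ))) ⟩
  Σᶠ (λ k → ∑[ τ ← allMaps m n ] 𝟙 (σ ≗? (k ∷ᶠ τ)))
    ≡⟨ ∑-cong (allFin n) (λ k → ∑-cong (allMaps m n) (𝟙-≗-∷ σ k)) ⟩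
  Σᶠ (λ k → ∑[ τ ← allMaps m n ] (𝟙 (σ zero ≟ k) * 𝟙 ((σ ∘ suc) ≗? τ)))
    ≡⟨ ∑-cong (allFin n) (λ k → trans (∑-*ˡ (allMaps m n) (𝟙 (σ zero ≟ k)) (λ τ → 𝟙 ((σ ∘ suc) ≗? τ)))
                                      (cong (𝟙 (σ zero ≟ k) *_) (∑-allMaps-𝟙≗ (σ ∘ suc)))) ⟩
  Σᶠ (λ k → 𝟙 (σ zero ≟ k) * 1ℚ)
    ≡⟨ Σᶠ-single (σ zero) (λ k k≢σ0 → trans (cong (_* 1ℚ) (𝟙-no (σ zero ≟ k) (k≢σ0 ∘ ≡.sym))) (*-zeroˡ 1ℚ)) ⟩
  𝟙 (σ zero ≟ σ zero) * 1ℚ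
    ≡⟨ trans (cong (_* 1ℚ) (𝟙-yes (σ zero ≟ σ zero) refl)) (*-identityˡ 1ℚ) ⟩
  1ℚ ∎
  where open ≡.≡-Reasoning

module _ {m n : ℕ} where

  ∑-allMaps-sift : ∀ {h : (Fin m → Fin n) → ℚ} → Congruent _≗_ _≡_ h →
                   ∀ σ → ∑[ τ ← allMaps m n ] (𝟙 (σ ≗? τ) * h τ) ≡ h σ
  ∑-allMaps-sift {h} h-cong σ = begin
    ∑[ τ ← A ] (𝟙 (σ ≗? τ) * h τ)  ≡⟨ ∑-cong A (λ τ → 𝟙-*-cong (σ ≗? τ) (λ σ≗τ → h-cong (≡.sym ∘ σ≗τ))) ⟩
    ∑[ τ ← A ] (𝟙 (σ ≗? τ) * h σ)  ≡⟨ ∑-*ʳ A (h σ) (λ τ → 𝟙 (σ ≗? τ)) ⟩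
    ∑[ τ ← A ] 𝟙 (σ ≗? τ) * h σ    ≡⟨ cong (_* h σ) (∑-allMaps-𝟙≗ σ) ⟩
    1ℚ * h σ                       ≡⟨ *-identityˡ (h σ) ⟩
    h σ                            ∎
    where
    open ≡.≡-Reasoning
    A = allMaps m n

  -- Double counting through the indicator of σ ≗ τ is needed because φ σ is in general only
  -- pointwise equal to an entry of allMaps m n.
  ∑-allMaps-bijection : ∀ {φ ψ : (Fin m → Fin n) → (Fin m → Fin n)} →
                        Congruent _≗_ _≗_ φ → Congruent _≗_ _≗_ ψ →
                        (∀ σ → ψ (φ σ) ≗ σ) → (∀ τ → φ (ψ τ) ≗ τ) →
                        ∀ {h} → Congruent _≗_ _≡_ h → ∑[ σ ← allMaps m n ] h (φ σ) ≡ ∑ (allMaps m n) h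
  ∑-allMaps-bijection {φ} {ψ} φ-cong ψ-cong ψ∘φ≗id φ∘ψ≗id {h} h-cong = begin
    ∑[ σ ← A ] h (φ σ)                          ≡⟨ ∑-cong A (λ σ → ≡.sym (∑-allMaps-sift h-cong (φ σ))) ⟩
    ∑[ σ ← A ] ∑[ τ ← A ] (𝟙 (φ σ ≗? τ) * h τ)  ≡⟨ ∑-comm A A (λ σ τ → 𝟙 (φ σ ≗? τ) * h τ) ⟩
    ∑[ τ ← A ] ∑[ σ ← A ] (𝟙 (φ σ ≗? τ) * h τ)  ≡⟨ ∑-cong A (λ τ → ∑-cong A (λ σ → cong (_* h τ)
                                                     (𝟙-⇔ (φ σ ≗? τ) (ψ τ ≗? σ) (to σ τ) (from σ τ)))) ⟩
    ∑[ τ ← A ] ∑[ σ ← A ] (𝟙 (ψ τ ≗? σ) * h τ)  ≡⟨ ∑-cong A (λ τ → ∑-allMaps-sift (λ _ → refl) (ψ τ)) ⟩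
    ∑[ τ ← A ] h τ                              ∎
    where
    open ≡.≡-Reasoning
    A = allMaps m n
    to : ∀ σ τ → φ σ ≗ τ → ψ τ ≗ σ
    to σ τ φσ≗τ x = trans (≡.sym (ψ-cong φσ≗τ x)) (ψ∘φ≗id σ x)
    from : ∀ σ τ → ψ τ ≗ σ → φ σ ≗ τ
    from σ τ ψτ≗σ x = trans (≡.sym (φ-cong ψτ≗σ x)) (φ∘ψ≗id τ x)

module _ {n : ℕ} where

  IsPerm-resp-≗ : {σ τ : Map n} → σ ≗ τ → IsPerm σ → IsPerm τ
  IsPerm-resp-≗ σ≗τ σ-inj i j τi≡τj = σ-inj i j (trans (σ≗τ i) (trans τi≡τj (≡.sym (σ≗τ j))))

  IsPerm-∘ : {σ τ : Map n} → IsPerm σ → IsPerm τ → IsPerm (σ ∘ τ)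
  IsPerm-∘ {τ = τ} σ-inj τ-inj i j στi≡στj = τ-inj i j (σ-inj (τ i) (τ j) στi≡στj)

  permutation-IsPerm : (π : Permutation n n) → IsPerm (π ⟨$⟩ʳ_)
  permutation-IsPerm π i j = Injection.injective (↔⇒↣ π)

IsPerm⇒surjective : ∀ {n} {σ : Map n} → IsPerm σ → ∀ j → ∃ λ i → σ i ≡ j
IsPerm⇒surjective {suc n} {σ} σ-inj j with any? (λ i → σ i ≟ j)
... | yes hit = hit
... | no miss = ⊥-elim (noCollision (pigeonhole (n<1+n n) (λ i → punchOut (j≢σ i))))
  where
  j≢σ : ∀ i → j ≢ σ i
  j≢σ i j≡σi = miss (i , ≡.sym j≡σi)
  -- if σ missed j, punching j out would turn σ into an injection Fin (suc n) → Fin n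
  noCollision : ¬ ∃₂ λ i k → i < k × punchOut (j≢σ i) ≡ punchOut (j≢σ k)
  noCollision (i , k , i<k , eq) = <⇒≢ i<k (σ-inj i k (punchOut-injective (j≢σ i) (j≢σ k) eq))

transpose-matchˡ : ∀ {n} (i j : Fin n) → transpose i j ⟨$⟩ʳ i ≡ j
transpose-matchˡ i j rewrite dec-true (i ≟ i) refl = refl

transpose-fixes : ∀ {n} {i j k : Fin n} → k ≢ i → k ≢ j → transpose i j ⟨$⟩ʳ k ≡ k
transpose-fixes {i = i} {j} {k} k≢i k≢j rewrite dec-false (k ≟ i) k≢i | dec-false (k ≟ j) k≢j = refl

module _ {A : Set} {n : ℕ} where

  permutation-invariant⇒constant : (Q : Fin (suc n) → A) → (∀ π x → Q (π ⟨$⟩ʳ x) ≡ Q x) →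
                                   ∀ x → Q x ≡ Q zero
  permutation-invariant⇒constant Q Q-inv x =
    trans (≡.sym (Q-inv (transpose x zero) x)) (cong Q (transpose-matchˡ x zero))

  permutation-invariant₂⇒constant : (Q : Fin (2+ n) → Fin (2+ n) → A) →
                                    (∀ π x y → Q (π ⟨$⟩ʳ x) (π ⟨$⟩ʳ y) ≡ Q x y) →
                                    ∀ {x y} → x ≢ y → Q x y ≡ Q zero (suc zero)
  permutation-invariant₂⇒constant Q Q-inv {x} {y} x≢y = begin
    Q x y                         ≡⟨ ≡.sym (Q-inv π₁ x y) ⟩
    Q (π₁ ⟨$⟩ʳ x) y′              ≡⟨ cong (λ z → Q z y′) (transpose-matchˡ x zero) ⟩
    Q zero y′                     ≡⟨ ≡.sym (Q-inv π₂ zero y′) ⟩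
    Q (π₂ ⟨$⟩ʳ zero) (π₂ ⟨$⟩ʳ y′)  ≡⟨ cong₂ Q (transpose-fixes (y′≢0 ∘ ≡.sym) (λ ()))
                                             (transpose-matchˡ y′ (suc zero)) ⟩
    Q zero (suc zero)             ∎
    where
    open ≡.≡-Reasoning
    π₁ = transpose x zero
    y′ = π₁ ⟨$⟩ʳ y
    y′≢0 : y′ ≢ zero
    y′≢0 y′≡0 = x≢y (permutation-IsPerm π₁ x y (trans (transpose-matchˡ x zero) (≡.sym y′≡0)))
    π₂ = transpose y′ (suc zero)

module _ {n : ℕ} where

  𝟙-isPerm?-cong : Congruent _≗_ _≡_ (λ (σ : Map n) → 𝟙 (isPerm? σ))
  𝟙-isPerm?-cong σ≗τ = 𝟙-⇔ (isPerm? _) (isPerm? _) (IsPerm-resp-≗ σ≗τ) (IsPerm-resp-≗ (≡.sym ∘ σ≗τ))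

  ∑-Sn-cong : {g h : Fun n} → (∀ σ → IsPerm σ → g σ ≡ h σ) → ∑ (Sn n) g ≡ ∑ (Sn n) h
  ∑-Sn-cong = ∑-filter-cong isPerm? (allMaps n n)

  ∑-Sn-bijection : ∀ {φ ψ : Map n → Map n} →
                   Congruent _≗_ _≗_ φ → Congruent _≗_ _≗_ ψ →
                   (∀ σ → ψ (φ σ) ≗ σ) → (∀ τ → φ (ψ τ) ≗ τ) →
                   (∀ σ → IsPerm σ → IsPerm (φ σ)) → (∀ τ → IsPerm τ → IsPerm (ψ τ)) →
                   ∀ {h} → Congruent _≗_ _≡_ h → ∑[ σ ← Sn n ] h (φ σ) ≡ ∑ (Sn n) h
  ∑-Sn-bijection {φ} {ψ} φ-cong ψ-cong ψ∘φ≗id φ∘ψ≗id φ-perm ψ-perm {h} h-cong = begin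
    ∑[ σ ← Sn n ] h (φ σ)                     ≡⟨ ∑-filter isPerm? A (h ∘ φ) ⟩
    ∑[ σ ← A ] (𝟙 (isPerm? σ) * h (φ σ))      ≡⟨ ∑-cong A (λ σ → cong (_* h (φ σ)) (𝟙-⇔ (isPerm? σ) (isPerm? (φ σ))
                                                   (φ-perm σ) (IsPerm-resp-≗ (ψ∘φ≗id σ) ∘ ψ-perm (φ σ)))) ⟩
    ∑[ σ ← A ] (𝟙 (isPerm? (φ σ)) * h (φ σ))  ≡⟨ ∑-allMaps-bijection φ-cong ψ-cong ψ∘φ≗id φ∘ψ≗id
                                                   (λ σ≗τ → cong₂ _*_ (𝟙-isPerm?-cong σ≗τ) (h-cong σ≗τ)) ⟩
    ∑[ σ ← A ] (𝟙 (isPerm? σ) * h σ)          ≡⟨ ≡.sym (∑-filter isPerm? A h) ⟩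
    ∑ (Sn n) h                                ∎
    where
    open ≡.≡-Reasoning
    A = allMaps n n

  ∑-Sn-∘ʳ : (π : Permutation n n) {h : Fun n} → Congruent _≗_ _≡_ h →
            ∑[ σ ← Sn n ] h (σ ∘ (π ⟨$⟩ʳ_)) ≡ ∑ (Sn n) h
  ∑-Sn-∘ʳ π = ∑-Sn-bijection (λ σ≗τ → σ≗τ ∘ (π ⟨$⟩ʳ_)) (λ σ≗τ → σ≗τ ∘ (π ⟨$⟩ˡ_))
    (λ σ _ → cong σ (inverseʳ π)) (λ τ _ → cong τ (inverseˡ π))
    (λ σ σ-perm → IsPerm-∘ σ-perm (permutation-IsPerm π))
    (λ τ τ-perm → IsPerm-∘ τ-perm (permutation-IsPerm (flip π)))

  ∑-Sn-∘ˡ : (π : Permutation n n) {h : Fun n} → Congruent _≗_ _≡_ h →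
            ∑[ σ ← Sn n ] h ((π ⟨$⟩ʳ_) ∘ σ) ≡ ∑ (Sn n) h
  ∑-Sn-∘ˡ π = ∑-Sn-bijection (λ σ≗τ → cong (π ⟨$⟩ʳ_) ∘ σ≗τ) (λ σ≗τ → cong (π ⟨$⟩ˡ_) ∘ σ≗τ)
    (λ σ _ → inverseˡ π) (λ τ _ → inverseʳ π)
    (λ σ σ-perm → IsPerm-∘ (permutation-IsPerm π) σ-perm)
    (λ τ τ-perm → IsPerm-∘ (permutation-IsPerm (flip π)) τ-perm)

  ∑-Sn-𝟙≗id : ∑[ σ ← Sn n ] 𝟙 (id ≗? σ) ≡ 1ℚ
  ∑-Sn-𝟙≗id = begin
    ∑[ σ ← Sn n ] 𝟙 (id ≗? σ)                 ≡⟨ ∑-filter isPerm? A (λ σ → 𝟙 (id ≗? σ)) ⟩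
    ∑[ σ ← A ] (𝟙 (isPerm? σ) * 𝟙 (id ≗? σ))  ≡⟨ ∑-cong A (λ σ → *-comm (𝟙 (isPerm? σ)) (𝟙 (id ≗? σ))) ⟩
    ∑[ σ ← A ] (𝟙 (id ≗? σ) * 𝟙 (isPerm? σ))  ≡⟨ ∑-allMaps-sift 𝟙-isPerm?-cong id ⟩
    𝟙 (isPerm? {n} id)                        ≡⟨ 𝟙-yes (isPerm? {n} id) (λ _ _ i≡j → i≡j) ⟩
    1ℚ                                        ∎
    where
    open ≡.≡-Reasoning
    A = allMaps n n

  ⟨⟩≡0 : {u v : Fun n} → (∀ σ → IsPerm σ → u σ * v σ ≡ 0ℚ) → ⟨ u , v ⟩ ≡ 0ℚ
  ⟨⟩≡0 uv≡0 = trans (cong (_* inv (length (Sn n))) (trans (∑-Sn-cong uv≡0) (∑-≡0 (Sn n) (λ _ → refl))))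
                    (*-zeroˡ (inv (length (Sn n))))

  x→-cong : ∀ i j → Congruent _≗_ _≡_ (x→ {n} i j)
  x→-cong i j σ≗τ = cong (λ k → 𝟙 (k ≟ j)) (σ≗τ i)

  x→-∘ˡ : ∀ (π : Permutation n n) i j (σ : Map n) → x→ i (π ⟨$⟩ʳ j) ((π ⟨$⟩ʳ_) ∘ σ) ≡ x→ i j σ
  x→-∘ˡ π i j σ = 𝟙-⇔ (π ⟨$⟩ʳ σ i ≟ π ⟨$⟩ʳ j) (σ i ≟ j) (permutation-IsPerm π (σ i) j) (cong (π ⟨$⟩ʳ_))

  x→-row-sum : ∀ (σ : Map n) i → Σᶠ (λ j → x→ i j σ) ≡ 1ℚ
  x→-row-sum σ i =
    trans (Σᶠ-single (σ i) (λ j j≢σi → 𝟙-no (σ i ≟ j) (j≢σi ∘ ≡.sym))) (𝟙-yes (σ i ≟ σ i) refl)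

  x→-column-sum : ∀ {σ : Map n} → IsPerm σ → ∀ j → Σᶠ (λ i → x→ i j σ) ≡ 1ℚ
  x→-column-sum {σ} σ-inj j with IsPerm⇒surjective σ-inj j
  ... | i₀ , σi₀≡j = trans
    (Σᶠ-single i₀ (λ i i≢i₀ → 𝟙-no (σ i ≟ j) (λ σi≡j → i≢i₀ (σ-inj i i₀ (trans σi≡j (≡.sym σi₀≡j))))))
    (𝟙-yes (σ i₀ ≟ j) σi₀≡j)

Sn-nonempty : ∀ n → length (Sn n) ≢ 0
Sn-nonempty n with Sn n | ∑-Sn-𝟙≗id {n}
... | []    | 0≡1 = λ _ → 1≢0 (≡.sym 0≡1)
... | _ ∷ _ | _   = λ ()

module _ {n : ℕ} where

  condSum : Fun n → Fin n → Fin n → ℚ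
  condSum u i j = ∑[ σ ← Sn n ] (x→ i j σ * u σ)

  count : Fin n → Fin n → ℚ
  count i j = ∑ (Sn n) (x→ i j)

  pairCount : Fin n → Fin n → Fin n → Fin n → ℚ
  pairCount i j k l = condSum (x→ k l) i j

  fiber : Fin n → Fin n → List (Map n)
  fiber i j = filter (λ σ → σ i ≟ j) (Sn n)

  𝔼→≡condSum : ∀ (u : Fun n) i j → 𝔼→ u i j ≡ condSum u i j * inv (length (fiber i j))
  𝔼→≡condSum u i j = cong (_* inv (length (fiber i j))) (∑-filter (λ σ → σ i ≟ j) (Sn n) u)

  length-fiber : ∀ i j → ℕ→ℚ (length (fiber i j)) ≡ count i j
  length-fiber i j = begin
    ℕ→ℚ (length (fiber i j))       ≡⟨ ∑-1 (fiber i j) ⟩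
    ∑[ _ ← fiber i j ] 1ℚ          ≡⟨ ∑-filter (λ σ → σ i ≟ j) (Sn n) (λ _ → 1ℚ) ⟩
    ∑[ σ ← Sn n ] (x→ i j σ * 1ℚ)  ≡⟨ ∑-cong (Sn n) (λ σ → *-identityʳ (x→ i j σ)) ⟩
    count i j                      ∎
    where open ≡.≡-Reasoning

  count≡pairCount : ∀ i j → count i j ≡ pairCount i j i j
  count≡pairCount i j = ∑-cong (Sn n) (λ σ → ≡.sym (𝟙-idem (σ i ≟ j)))

  condSum-const : ∀ κ i j → condSum (λ _ → κ) i j ≡ count i j * κ
  condSum-const κ i j = ∑-*ʳ (Sn n) κ (x→ i j)

  condSum-- : ∀ (u v : Fun n) i j → condSum (λ σ → u σ - v σ) i j ≡ condSum u i j - condSum v i j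
  condSum-- u v i j = trans
    (∑-cong (Sn n) (λ σ → solve 3 (λ x a b → x :* (a :- b) := x :* a :- x :* b) refl (x→ i j σ) (u σ) (v σ)))
    (∑-- (Sn n) (λ σ → x→ i j σ * u σ) (λ σ → x→ i j σ * v σ))

  Σᶠ-condSum : ∀ (w : Fin n → Map n → ℚ) (u : Fun n) →
               Σᶠ (λ j → ∑[ σ ← Sn n ] (w j σ * u σ)) ≡ ∑[ σ ← Sn n ] (Σᶠ (λ j → w j σ) * u σ)
  Σᶠ-condSum w u = trans (≡.sym (∑-comm (Sn n) (allFin n) (λ σ j → w j σ * u σ)))
                         (∑-cong (Sn n) (λ σ → ∑-*ʳ (allFin n) (u σ) (λ j → w j σ)))

  condSum-row-sum : ∀ (u : Fun n) i → Σᶠ (λ j → condSum u i j) ≡ ∑ (Sn n) u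
  condSum-row-sum u i = trans (Σᶠ-condSum (λ j → x→ i j) u)
    (∑-cong (Sn n) (λ σ → trans (cong (_* u σ) (x→-row-sum σ i)) (*-identityˡ (u σ))))

  condSum-column-sum : ∀ (u : Fun n) j → Σᶠ (λ i → condSum u i j) ≡ ∑ (Sn n) u
  condSum-column-sum u j = trans (Σᶠ-condSum (λ i → x→ i j) u)
    (∑-Sn-cong (λ σ σ-perm → trans (cong (_* u σ) (x→-column-sum σ-perm j)) (*-identityˡ (u σ))))

  ∑-lin : ∀ (b : Fin n → Fin n → ℚ) (u : Fun n) →
          ∑[ σ ← Sn n ] (lin b σ * u σ) ≡ Σᶠ² (λ i j → b i j * condSum u i j)
  ∑-lin b u = begin
    ∑[ σ ← Sn n ] (lin b σ * u σ)
      ≡⟨ ∑-cong (Sn n) expand ⟩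
    ∑[ σ ← Sn n ] Σᶠ (λ i → Σᶠ (λ j → b i j * (x→ i j σ * u σ)))
      ≡⟨ ∑-comm (Sn n) (allFin n) _ ⟩
    Σᶠ (λ i → ∑[ σ ← Sn n ] Σᶠ (λ j → b i j * (x→ i j σ * u σ)))
      ≡⟨ ∑-cong (allFin n) (λ i → ∑-comm (Sn n) (allFin n) _) ⟩
    Σᶠ (λ i → Σᶠ (λ j → ∑[ σ ← Sn n ] (b i j * (x→ i j σ * u σ))))
      ≡⟨ ∑-cong (allFin n) (λ i → ∑-cong (allFin n) (λ j → ∑-*ˡ (Sn n) (b i j) (λ σ → x→ i j σ * u σ))) ⟩
    Σᶠ² (λ i j → b i j * condSum u i j) ∎
    where
    open ≡.≡-Reasoning
    expand : ∀ σ → lin b σ * u σ ≡ Σᶠ (λ i → Σᶠ (λ j → b i j * (x→ i j σ * u σ)))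
    expand σ = trans (≡.sym (∑-*ʳ (allFin n) (u σ) (λ i → Σᶠ (λ j → b i j * x→ i j σ))))
      (∑-cong (allFin n) (λ i → trans (≡.sym (∑-*ʳ (allFin n) (u σ) (λ j → b i j * x→ i j σ)))
        (∑-cong (allFin n) (λ j → *-assoc (b i j) (x→ i j σ) (u σ)))))

  ∑-lin-const : ∀ (b : Fin n → Fin n → ℚ) (u : Fun n) κ → (∀ i j → condSum u i j ≡ κ) →
                ∑[ σ ← Sn n ] (lin b σ * u σ) ≡ Σᶠ² b * κ
  ∑-lin-const b u κ condSum≡κ = trans (∑-lin b u)
    (trans (∑-cong (allFin n) (λ i → ∑-cong (allFin n) (λ j → cong (b i j *_) (condSum≡κ i j)))) (Σᶠ²-*ʳ b κ))

  condSum-lin : ∀ (b : Fin n → Fin n → ℚ) k l →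
                condSum (lin b) k l ≡ Σᶠ² (λ i j → b i j * pairCount i j k l)
  condSum-lin b k l = trans (∑-cong (Sn n) (λ σ → *-comm (x→ k l σ) (lin b σ))) (∑-lin b (x→ k l))

  pairCount-positions : ∀ (π : Permutation n n) i j k l →
                        pairCount (π ⟨$⟩ʳ i) j (π ⟨$⟩ʳ k) l ≡ pairCount i j k l
  pairCount-positions π i j k l = ∑-Sn-∘ʳ π (λ σ≗τ → cong₂ _*_ (x→-cong i j σ≗τ) (x→-cong k l σ≗τ))

  pairCount-values : ∀ (π : Permutation n n) i j k l →
                     pairCount i (π ⟨$⟩ʳ j) k (π ⟨$⟩ʳ l) ≡ pairCount i j k l
  pairCount-values π i j k l = begin
    pairCount i (π ⟨$⟩ʳ j) k (π ⟨$⟩ʳ l)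
      ≡⟨ ≡.sym (∑-Sn-∘ˡ π (λ σ≗τ → cong₂ _*_ (x→-cong i _ σ≗τ) (x→-cong k _ σ≗τ))) ⟩
    ∑[ σ ← Sn n ] (x→ i (π ⟨$⟩ʳ j) ((π ⟨$⟩ʳ_) ∘ σ) * x→ k (π ⟨$⟩ʳ l) ((π ⟨$⟩ʳ_) ∘ σ))
      ≡⟨ ∑-cong (Sn n) (λ σ → cong₂ _*_ (x→-∘ˡ π i j σ) (x→-∘ˡ π k l σ)) ⟩
    pairCount i j k l ∎
    where open ≡.≡-Reasoning

  pairCount-same-position : ∀ i {j l} → j ≢ l → pairCount i j i l ≡ 0ℚ
  pairCount-same-position i {j} {l} j≢l = ∑-≡0 (Sn n) (λ σ → trans
    (𝟙-*-cong (σ i ≟ j) (λ σi≡j → 𝟙-no (σ i ≟ l) (j≢l ∘ trans (≡.sym σi≡j))))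
    (*-zeroʳ (x→ i j σ)))

  pairCount-same-value : ∀ {i k} j → i ≢ k → pairCount i j k j ≡ 0ℚ
  pairCount-same-value {i} {k} j i≢k = trans
    (∑-Sn-cong (λ σ σ-inj → trans
      (𝟙-*-cong (σ i ≟ j) (λ σi≡j → 𝟙-no (σ k ≟ j) (i≢k ∘ σ-inj i k ∘ trans σi≡j ∘ ≡.sym)))
      (*-zeroʳ (x→ i j σ))))
    (∑-≡0 (Sn n) (λ _ → refl))

module Counting (m : ℕ) where

  S : List (Map (suc m))
  S = Sn (suc m)

  N N⁻¹ n⁻¹ c c⁻¹ : ℚ
  N   = ℕ→ℚ (length S)
  N⁻¹ = inv (length S)
  n⁻¹ = inv (suc m)
  c   = count {suc m} zero zero
  c⁻¹ = inv (length (fiber {suc m} zero zero))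

  N*N⁻¹≡1 : N * N⁻¹ ≡ 1ℚ
  N*N⁻¹≡1 = ℕ→ℚ-*-inv (Sn-nonempty (suc m))

  n*n⁻¹≡1 : ℕ→ℚ (suc m) * n⁻¹ ≡ 1ℚ
  n*n⁻¹≡1 = ℕ→ℚ-*-inv {suc m} (λ ())

  count≡c : ∀ (i j : Fin (suc m)) → count i j ≡ c
  count≡c i j = begin
    count i j                              ≡⟨ count≡pairCount i j ⟩
    pairCount i j i j                      ≡⟨ permutation-invariant⇒constant (λ x → pairCount x j x j)
                                                (λ π x → pairCount-positions π x j x j) i ⟩
    pairCount zero j zero j                ≡⟨ permutation-invariant⇒constant (λ y → pairCount {suc m} zero y zero y)
                                                (λ π y → pairCount-values π zero y zero y) j ⟩
    pairCount {suc m} zero zero zero zero  ≡⟨ ≡.sym (count≡pairCount {suc m} zero zero) ⟩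
    c                                      ∎
    where open ≡.≡-Reasoning

  condSum-const≡c* : ∀ κ (i j : Fin (suc m)) → condSum (λ _ → κ) i j ≡ c * κ
  condSum-const≡c* κ i j = trans (condSum-const κ i j) (cong (_* κ) (count≡c i j))

  n*c≡N : ℕ→ℚ (suc m) * c ≡ N
  n*c≡N = begin
    ℕ→ℚ (suc m) * c                               ≡⟨ ≡.sym (Σᶠ-const (suc m) c) ⟩
    Σᶠ {suc m} (λ _ → c)                          ≡⟨ ∑-cong (allFin (suc m)) (λ j → ≡.sym
                                                       (trans (condSum-const≡c* 1ℚ zero j) (*-identityʳ c))) ⟩
    Σᶠ (λ j → condSum {suc m} (λ _ → 1ℚ) zero j)  ≡⟨ condSum-row-sum {suc m} (λ _ → 1ℚ) zero ⟩
    ∑[ _ ← S ] 1ℚ                                 ≡⟨ ≡.sym (∑-1 S) ⟩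
    N                                             ∎
    where open ≡.≡-Reasoning

  c≢0 : c ≢ 0ℚ
  c≢0 c≡0 = 1≢0 (begin
    1ℚ                      ≡⟨ ≡.sym N*N⁻¹≡1 ⟩
    N * N⁻¹                 ≡⟨ cong (_* N⁻¹) (≡.sym n*c≡N) ⟩
    ℕ→ℚ (suc m) * c * N⁻¹   ≡⟨ cong (λ x → ℕ→ℚ (suc m) * x * N⁻¹) c≡0 ⟩
    ℕ→ℚ (suc m) * 0ℚ * N⁻¹  ≡⟨ cong (_* N⁻¹) (*-zeroʳ (ℕ→ℚ (suc m))) ⟩
    0ℚ * N⁻¹                ≡⟨ *-zeroˡ N⁻¹ ⟩
    0ℚ                      ∎)
    where open ≡.≡-Reasoning

  c*inv-fiber≡1 : ∀ (i j : Fin (suc m)) → c * inv (length (fiber i j)) ≡ 1ℚ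
  c*inv-fiber≡1 i j = trans (cong (_* inv ℓ) c≡ℓ) (ℕ→ℚ-*-inv {ℓ} (λ ℓ≡0 → c≢0 (trans c≡ℓ (cong ℕ→ℚ ℓ≡0))))
    where
    ℓ = length (fiber i j)
    c≡ℓ : c ≡ ℕ→ℚ ℓ
    c≡ℓ = ≡.sym (trans (length-fiber i j) (count≡c i j))

  c*c⁻¹≡1 : c * c⁻¹ ≡ 1ℚ
  c*c⁻¹≡1 = c*inv-fiber≡1 zero zero

  inv-fiber≡c⁻¹ : ∀ (i j : Fin (suc m)) → inv (length (fiber i j)) ≡ c⁻¹
  inv-fiber≡c⁻¹ i j = *-inverse-unique {c} (c*inv-fiber≡1 i j) c*c⁻¹≡1

  n*N⁻¹≡c⁻¹ : ℕ→ℚ (suc m) * N⁻¹ ≡ c⁻¹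
  n*N⁻¹≡c⁻¹ = *-inverse-unique {c} (begin
    c * (ℕ→ℚ (suc m) * N⁻¹)  ≡⟨ solve 3 (λ c n x → c :* (n :* x) := (n :* c) :* x) refl c (ℕ→ℚ (suc m)) N⁻¹ ⟩
    ℕ→ℚ (suc m) * c * N⁻¹    ≡⟨ cong (_* N⁻¹) n*c≡N ⟩
    N * N⁻¹                  ≡⟨ N*N⁻¹≡1 ⟩
    1ℚ                       ∎) c*c⁻¹≡1
    where open ≡.≡-Reasoning

  c*N⁻¹≡n⁻¹ : c * N⁻¹ ≡ n⁻¹
  c*N⁻¹≡n⁻¹ = *-inverse-unique {ℕ→ℚ (suc m)}
    (trans (≡.sym (*-assoc (ℕ→ℚ (suc m)) c N⁻¹)) (trans (cong (_* N⁻¹) n*c≡N) N*N⁻¹≡1)) n*n⁻¹≡1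

  -- Against v = lin b only the sums condSum u k l matter, and ⟨ v , 1 ⟩ = 0 forces Σ b = 0.
  condSum-const⇒⟂V1 : ∀ (u : Fun (suc m)) κ → (∀ k l → condSum u k l ≡ κ) →
                      ∀ v → InV1 v → ⟨ u , v ⟩ ≡ 0ℚ
  condSum-const⇒⟂V1 u κ condSum≡κ v ((b , v≐lin) , v⟂1) = begin
    ⟨ u , v ⟩                         ≡⟨ cong (_* N⁻¹) (∑-Sn-cong (λ σ σ-perm →
                                           trans (*-comm (u σ) (v σ)) (cong (_* u σ) (v≐lin σ σ-perm)))) ⟩
    ∑[ σ ← S ] (lin b σ * u σ) * N⁻¹  ≡⟨ cong (_* N⁻¹) (∑-lin-const b u κ condSum≡κ) ⟩
    Σᶠ² b * κ * N⁻¹                   ≡⟨ cong (λ x → x * κ * N⁻¹) Σb≡0 ⟩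
    0ℚ * κ * N⁻¹                      ≡⟨ trans (cong (_* N⁻¹) (*-zeroˡ κ)) (*-zeroˡ N⁻¹) ⟩
    0ℚ                                ∎
    where
    open ≡.≡-Reasoning
    Σb≡0 : Σᶠ² b ≡ 0ℚ
    Σb≡0 = x*y≡0⇒x≡0 (trans (cong (_* c⁻¹) (*-identityʳ c)) c*c⁻¹≡1) (begin
      Σᶠ² b * (c * 1ℚ)           ≡⟨ ≡.sym (∑-lin-const b (λ _ → 1ℚ) (c * 1ℚ) (condSum-const≡c* 1ℚ)) ⟩
      ∑[ σ ← S ] (lin b σ * 1ℚ)  ≡⟨ ∑-Sn-cong (λ σ σ-perm → cong (_* 1ℚ) (≡.sym (v≐lin σ σ-perm))) ⟩
      ∑[ σ ← S ] (v σ * 1ℚ)      ≡⟨ x*y≡0⇒x≡0 (trans (*-comm N⁻¹ N) N*N⁻¹≡1) (v⟂1 1ℚ) ⟩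
      0ℚ                         ∎)

module Projection (m : ℕ) (f : Fun (suc m)) where
  open Counting m

  F ρ : ℚ
  F = ∑ S f
  ρ = ℕ→ℚ m * n⁻¹

  coeff≡ : ∀ i j → coeff f i j ≡ ρ * (condSum f i j * c⁻¹ - F * N⁻¹)
  coeff≡ i j = cong (λ e → ρ * (e - F * N⁻¹))
    (trans (𝔼→≡condSum f i j) (cong (condSum f i j *_) (inv-fiber≡c⁻¹ i j)))

  centred-sum≡0 : ∀ (G : Fin (suc m) → ℚ) → Σᶠ G ≡ F → Σᶠ (λ j → ρ * (G j * c⁻¹ - F * N⁻¹)) ≡ 0ℚ
  centred-sum≡0 G ΣG≡F = begin
    Σᶠ (λ j → ρ * (G j * c⁻¹ - F * N⁻¹))
      ≡⟨ ∑-*ˡ (allFin (suc m)) ρ (λ j → G j * c⁻¹ - F * N⁻¹) ⟩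
    ρ * Σᶠ (λ j → G j * c⁻¹ - F * N⁻¹)
      ≡⟨ cong (ρ *_) (∑-- (allFin (suc m)) (λ j → G j * c⁻¹) (λ _ → F * N⁻¹)) ⟩
    ρ * (Σᶠ (λ j → G j * c⁻¹) - Σᶠ {suc m} (λ _ → F * N⁻¹))
      ≡⟨ cong₂ (λ x y → ρ * (x - y)) (trans (∑-*ʳ (allFin (suc m)) c⁻¹ G) (cong (_* c⁻¹) ΣG≡F))
                                     (Σᶠ-const (suc m) (F * N⁻¹)) ⟩
    ρ * (F * c⁻¹ - ℕ→ℚ (suc m) * (F * N⁻¹))
      ≡⟨ cong (λ x → ρ * (F * c⁻¹ - x))
           (trans (solve 3 (λ n F x → n :* (F :* x) := F :* (n :* x)) refl (ℕ→ℚ (suc m)) F N⁻¹)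
                  (cong (F *_) n*N⁻¹≡c⁻¹)) ⟩
    ρ * (F * c⁻¹ - F * c⁻¹)
      ≡⟨ solve 2 (λ ρ x → ρ :* (x :- x) := con 0ℚ) refl ρ (F * c⁻¹) ⟩
    0ℚ ∎
    where open ≡.≡-Reasoning

  coeff-normalized : Normalized (coeff f)
  coeff-normalized =
    (λ i → trans (∑-cong (allFin (suc m)) (coeff≡ i))
                 (centred-sum≡0 (condSum f i) (condSum-row-sum f i))) ,
    (λ j → trans (∑-cong (allFin (suc m)) (λ i → coeff≡ i j))
                 (centred-sum≡0 (λ i → condSum f i j) (condSum-column-sum f j)))

  lin-coeff∈V1 : InV1 (lin (coeff f))
  lin-coeff∈V1 = (coeff f , λ _ _ → refl) , λ κ → begin
    ⟨ lin (coeff f) , (λ _ → κ) ⟩  ≡⟨ cong (_* N⁻¹) (∑-lin-const (coeff f) (λ _ → κ) (c * κ) (condSum-const≡c* κ)) ⟩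
    Σᶠ² (coeff f) * (c * κ) * N⁻¹  ≡⟨ cong (λ x → x * (c * κ) * N⁻¹)
                                           (Normalized⇒Σᶠ²≡0 {a = coeff f} coeff-normalized) ⟩
    0ℚ * (c * κ) * N⁻¹             ≡⟨ trans (cong (_* N⁻¹) (*-zeroˡ (c * κ))) (*-zeroˡ N⁻¹) ⟩
    0ℚ                             ∎
    where open ≡.≡-Reasoning

  residual-⟂V1 : (∀ k l → condSum (lin (coeff f)) k l ≡ condSum f k l - F * n⁻¹) →
                 ∀ v → InV1 v → ⟨ (λ σ → f σ - lin (coeff f) σ) , v ⟩ ≡ 0ℚ
  residual-⟂V1 condSum-lin≡ = condSum-const⇒⟂V1 _ (F * n⁻¹) condSum-residual
    where
    open ≡.≡-Reasoning
    condSum-residual : ∀ k l → condSum (λ σ → f σ - lin (coeff f) σ) k l ≡ F * n⁻¹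
    condSum-residual k l = begin
      condSum (λ σ → f σ - lin (coeff f) σ) k l    ≡⟨ condSum-- f (lin (coeff f)) k l ⟩
      condSum f k l - condSum (lin (coeff f)) k l  ≡⟨ cong (λ x → condSum f k l - x) (condSum-lin≡ k l) ⟩
      condSum f k l - (condSum f k l - F * n⁻¹)    ≡⟨ solve 2 (λ x y → x :- (x :- y) := y)
                                                              refl (condSum f k l) (F * n⁻¹) ⟩
      F * n⁻¹                                      ∎

condSum-lin-coeff₁ : ∀ (f : Fun 1) k l → condSum (lin (coeff f)) k l ≡ condSum f k l - Projection.F 0 f * 1ℚ
condSum-lin-coeff₁ f zero zero = begin
  condSum (lin (coeff f)) zero zero
    ≡⟨ condSum-lin (coeff f) zero zero ⟩
  Σᶠ² (λ i j → coeff f i j * pairCount i j zero zero)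
    ≡⟨ ∑-≡0 (allFin 1) (λ i → ∑-≡0 (allFin 1) (λ j →
         trans (cong (_* pairCount i j zero zero) (coeff≡0 i j)) (*-zeroˡ (pairCount i j zero zero)))) ⟩
  0ℚ
    ≡⟨ solve 1 (λ x → con 0ℚ := x :- x :* con 1ℚ) refl (condSum f zero zero) ⟩
  condSum f zero zero - condSum f zero zero * 1ℚ
    ≡⟨ cong (λ x → condSum f zero zero - x * 1ℚ) condSum≡F ⟩
  condSum f zero zero - F * 1ℚ ∎
  where
  open ≡.≡-Reasoning
  open Projection 0 f
  coeff≡0 : ∀ i j → coeff f i j ≡ 0ℚ
  coeff≡0 i j = trans (cong (_* (𝔼→ f i j - 𝔼 f)) (*-zeroˡ (inv 1))) (*-zeroˡ (𝔼→ f i j - 𝔼 f))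
  condSum≡F : condSum f zero zero ≡ F
  condSum≡F = trans (≡.sym (Σᶠ-single {h = condSum f zero} zero (λ { zero 0≢0 → ⊥-elim (0≢0 refl) ; (suc ()) _ })))
                    (condSum-row-sum f zero)

module PairCounts (m : ℕ) where
  open Counting (suc m)

  d : ℚ
  d = pairCount {2+ m} zero zero (suc zero) (suc zero)

  pairCount-off-diagonal : ∀ {i j k l : Fin (2+ m)} → i ≢ k → j ≢ l → pairCount i j k l ≡ d
  pairCount-off-diagonal {i} {j} {k} {l} i≢k j≢l = trans
    (permutation-invariant₂⇒constant (λ x y → pairCount x j y l)
       (λ π x y → pairCount-positions π x j y l) i≢k)
    (permutation-invariant₂⇒constant (λ x y → pairCount zero x (suc zero) y)
       (λ π x y → pairCount-values π zero x (suc zero) y) j≢l)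

  pairCount≡pairPattern : ∀ (i j k l : Fin (2+ m)) → pairCount i j k l ≡ pairPattern c d (𝟙 (i ≟ k)) (𝟙 (j ≟ l))
  pairCount≡pairPattern i j k l with i ≟ k | j ≟ l
  ... | yes refl | yes refl = trans (≡.sym (count≡pairCount i j)) (trans (count≡c i j)
    (solve 2 (λ c d → c := con 1ℚ :* con 1ℚ :* c :+ (con 1ℚ :- con 1ℚ) :* (con 1ℚ :- con 1ℚ) :* d) refl c d))
  ... | yes refl | no j≢l   = trans (pairCount-same-position i j≢l)
    (solve 2 (λ c d → con 0ℚ := con 1ℚ :* con 0ℚ :* c :+ (con 1ℚ :- con 1ℚ) :* (con 1ℚ :- con 0ℚ) :* d) refl c d)
  ... | no i≢k   | yes refl = trans (pairCount-same-value j i≢k)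
    (solve 2 (λ c d → con 0ℚ := con 0ℚ :* con 1ℚ :* c :+ (con 1ℚ :- con 0ℚ) :* (con 1ℚ :- con 1ℚ) :* d) refl c d)
  ... | no i≢k   | no j≢l   = trans (pairCount-off-diagonal i≢k j≢l)
    (solve 2 (λ c d → d := con 0ℚ :* con 0ℚ :* c :+ (con 1ℚ :- con 0ℚ) :* (con 1ℚ :- con 0ℚ) :* d) refl c d)

  n-1*d≡c : ℕ→ℚ (suc m) * d ≡ c
  n-1*d≡c = begin
    ℕ→ℚ (suc m) * d            ≡⟨ ≡.sym (Σᶠ-const (suc m) d) ⟩
    Σᶠ {suc m} (λ _ → d)       ≡⟨ ∑-cong (allFin (suc m)) (λ l → ≡.sym (pairCount-off-diagonal (λ ()) (λ ()))) ⟩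
    Σᶠ (row ∘ suc)             ≡⟨ ≡.sym (+-identityˡ (Σᶠ (row ∘ suc))) ⟩
    0ℚ + Σᶠ (row ∘ suc)        ≡⟨ cong (_+ Σᶠ (row ∘ suc))
                                    (≡.sym (pairCount-same-value {2+ m} {suc zero} {zero} zero (λ ()))) ⟩
    row zero + Σᶠ (row ∘ suc)  ≡⟨ ≡.sym (Σᶠ-suc row) ⟩
    Σᶠ row                     ≡⟨ condSum-row-sum {2+ m} (x→ zero zero) (suc zero) ⟩
    c                          ∎
    where
    open ≡.≡-Reasoning
    row : Fin (2+ m) → ℚ
    row l = pairCount (suc zero) l zero zero

  condSum-lin-normalized : ∀ {b : Fin (2+ m) → Fin (2+ m) → ℚ} → Normalized b →
                           ∀ k l → condSum (lin b) k l ≡ b k l * (c + d)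
  condSum-lin-normalized {b} b-normalized k l = begin
    condSum (lin b) k l
      ≡⟨ condSum-lin b k l ⟩
    Σᶠ² (λ i j → b i j * pairCount i j k l)
      ≡⟨ ∑-cong (allFin (2+ m)) (λ i → ∑-cong (allFin (2+ m)) (λ j →
           cong (b i j *_) (pairCount≡pairPattern i j k l))) ⟩
    Σᶠ² (λ i j → b i j * pairPattern c d (𝟙 (i ≟ k)) (𝟙 (j ≟ l)))
      ≡⟨ Normalized⇒Σᶠ²-pairPattern {A = b} b-normalized c d k l ⟩
    b k l * (c + d) ∎
    where open ≡.≡-Reasoning

  condSum-lin-coeff : ∀ (f : Fun (2+ m)) k l →
                      condSum (lin (coeff f)) k l ≡ condSum f k l - Projection.F (suc m) f * n⁻¹
  condSum-lin-coeff f k l = begin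
    condSum (lin (coeff f)) k l
      ≡⟨ condSum-lin-normalized {coeff f} coeff-normalized k l ⟩
    coeff f k l * (c + d)
      ≡⟨ cong (_* (c + d)) (coeff≡ k l) ⟩
    ρ * e * (c + d)
      ≡⟨ solve 4 (λ ρ e c d → ρ :* e :* (c :+ d) := e :* (ρ :* (c :+ d))) refl ρ e c d ⟩
    e * (ρ * (c + d))
      ≡⟨ cong (e *_) ρ*[c+d]≡c ⟩
    (condSum f k l * c⁻¹ - F * N⁻¹) * c
      ≡⟨ solve 5 (λ x c⁻¹ F N⁻¹ c → (x :* c⁻¹ :- F :* N⁻¹) :* c := x :* (c :* c⁻¹) :- F :* (c :* N⁻¹))
                 refl (condSum f k l) c⁻¹ F N⁻¹ c ⟩
    condSum f k l * (c * c⁻¹) - F * (c * N⁻¹)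
      ≡⟨ cong₂ (λ x y → condSum f k l * x - F * y) c*c⁻¹≡1 c*N⁻¹≡n⁻¹ ⟩
    condSum f k l * 1ℚ - F * n⁻¹
      ≡⟨ cong (_- F * n⁻¹) (*-identityʳ (condSum f k l)) ⟩
    condSum f k l - F * n⁻¹ ∎
    where
    open ≡.≡-Reasoning
    open Projection (suc m) f
    e = condSum f k l * c⁻¹ - F * N⁻¹
    ρ*[c+d]≡c : ρ * (c + d) ≡ c
    ρ*[c+d]≡c = begin
      ℕ→ℚ (suc m) * n⁻¹ * (c + d)
        ≡⟨ solve 4 (λ k x c d → k :* x :* (c :+ d) := x :* (k :* c :+ k :* d)) refl (ℕ→ℚ (suc m)) n⁻¹ c d ⟩
      n⁻¹ * (ℕ→ℚ (suc m) * c + ℕ→ℚ (suc m) * d)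
        ≡⟨ cong (λ x → n⁻¹ * (ℕ→ℚ (suc m) * c + x)) n-1*d≡c ⟩
      n⁻¹ * (ℕ→ℚ (suc m) * c + c)
        ≡⟨ solve 3 (λ x k c → x :* (k :* c :+ c) := ((con 1ℚ :+ k) :* x) :* c) refl n⁻¹ (ℕ→ℚ (suc m)) c ⟩
      (1ℚ + ℕ→ℚ (suc m)) * n⁻¹ * c
        ≡⟨ cong (λ x → x * n⁻¹ * c) (≡.sym (ℕ→ℚ-suc (suc m))) ⟩
      ℕ→ℚ (2+ m) * n⁻¹ * c
        ≡⟨ trans (cong (_* c) n*n⁻¹≡1) (*-identityˡ c) ⟩
      c ∎

condSum-lin-coeff : ∀ m (f : Fun (suc m)) k l →
                    condSum (lin (coeff f)) k l ≡ condSum f k l - Projection.F m f * Counting.n⁻¹ m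
condSum-lin-coeff zero    = condSum-lin-coeff₁
condSum-lin-coeff (suc m) = PairCounts.condSum-lin-coeff m

S₀-projection : ∀ (f : Fun 0) → Normalized (coeff f) × IsProjV1 f (lin (coeff f))
S₀-projection f =
  ((λ ()) , (λ ())) ,
  ((coeff f , λ _ _ → refl) , λ κ → ⟨⟩≡0 {u = lin (coeff f)} {v = λ _ → κ} (λ _ _ → *-zeroˡ κ)) ,
  λ { v ((_ , v≐0) , _) → ⟨⟩≡0 {u = λ σ → f σ - 0ℚ}
        (λ σ σ-perm → trans (cong ((f σ - 0ℚ) *_) (v≐0 σ σ-perm)) (*-zeroʳ (f σ - 0ℚ))) }

lemma3p2 : (n : ℕ) (f : Fun n) →
    Normalized (coeff f) × IsProjV1 f (lin (coeff f))
lemma3p2 zero    f = S₀-projection f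
lemma3p2 (suc m) f = coeff-normalized , lin-coeff∈V1 , residual-⟂V1 (condSum-lin-coeff m f)
  where open Projection m f
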